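{- The laws $x\sqcup(y\sqcup z)=(x\sqcup y)\sqcup z$, $x\sqcup x=x$ and $x\sqcup y\sqcup x=x\sqcup y$ are sound and complete for the equational theory of $\{\sqcup\}$-algebras of functions: an equation in $\sqcup$ holds in all $\{\sqcup\}$-algebras of functions if and only if it is derivable from these three laws.
   Context: $\mathcal{P}(X,Y)$ is the set of partial functions from nonempty $X$ to nonempty $Y$; override is $(f\sqcup g)(x)=f(x)$ if $x\in\mathrm{dom}(f)$, $=g(x)$ if $x\in\mathrm{dom}(g)\setminus\mathrm{dom}(f)$, undefined otherwise. A $\{\sqcup\}$-algebra of functions is a subset of some $\mathcal{P}(X,Y)$ closed under $\sqcup$. -}

module Defs where

open import Data.Nat using (ℕ)
open import Data.Maybe using (Maybe; just; nothing)
open import Relation.Binary.PropositionalEquality using (_≡_)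

infixl 6 _⊔ₜ_
data Term : Set where
  var   : ℕ → Term
  _⊔ₜ_  : Term → Term → Term

subst : (ℕ → Term) → Term → Term
subst σ (var n)  = σ n
subst σ (t ⊔ₜ u) = subst σ t ⊔ₜ subst σ u

infix 4 _⊢≈_
data _⊢≈_ : Term → Term → Set where
  assoc  : ∀ x y z → x ⊔ₜ (y ⊔ₜ z) ⊢≈ (x ⊔ₜ y) ⊔ₜ z
  idem   : ∀ x → x ⊔ₜ x ⊢≈ x
  lreg   : ∀ x y → (x ⊔ₜ y) ⊔ₜ x ⊢≈ x ⊔ₜ y
  refl≈  : ∀ {t} → t ⊢≈ t
  sym≈   : ∀ {t u} → t ⊢≈ u → u ⊢≈ t
  trans≈ : ∀ {t u v} → t ⊢≈ u → u ⊢≈ v → t ⊢≈ v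
  cong≈  : ∀ {t t' u u'} → t ⊢≈ t' → u ⊢≈ u' → t ⊔ₜ u ⊢≈ t' ⊔ₜ u'

PFun : Set → Set → Set
PFun X Y = X → Maybe Y

_⊔_ : ∀ {X Y : Set} → PFun X Y → PFun X Y → PFun X Y
(f ⊔ g) x with f x
... | just y  = just y
... | nothing = g x

-- A {⊔}-algebra of functions: a subset of P(X,Y) (X, Y nonempty) closed under ⊔.
record ⊔-Algebra : Set₁ where
  field
    X        : Set
    Y        : Set
    x₀       : X
    y₀       : Y
    carrier  : PFun X Y → Set
    closed   : ∀ {f g} → carrier f → carrier g → carrier (f ⊔ g)

⟦_⟧ : ∀ {X Y : Set} → Term → (ℕ → PFun X Y) → PFun X Y
⟦ var n ⟧  v = v n
⟦ t ⊔ₜ u ⟧ v = ⟦ t ⟧ v ⊔ ⟦ u ⟧ v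

_⊨_≈_ : ⊔-Algebra → Term → Term → Set
A ⊨ t ≈ u = (v : ℕ → PFun X Y) → (∀ n → carrier (v n)) → ∀ x → ⟦ t ⟧ v x ≡ ⟦ u ⟧ v x
  where open ⊔-Algebra A

⊨_≈_ : Term → Term → Set₁
⊨ t ≈ u = (A : ⊔-Algebra) → A ⊨ t ≈ u

-- Pointwise, override is the "first defined" operation a <∣> b on Maybe Y,
-- so every term t evaluates at a point to  eval t ρ  for the vector
-- ρ n = (value of variable n there).  Soundness is then the fact that <∣>
-- is associative, idempotent and left regular.
--
-- Completeness goes through normal forms.  Let  word t  be the list of
-- variables of t from left to right.  Associativity gives t ≈ (word t joined
-- from the left), and idempotence plus left regularity let us delete every
-- repeated occurrence of a variable, so t ≈ nf t, the join of the
-- duplicate-free list  deduplicate (word t).  Semantically, eval t ρ is the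
-- first defined entry of ρ along word t, unchanged by deduplication.  In the
-- algebra of all partial functions from sets of variables to ℕ, where
-- variable n is defined (with value n) exactly on the sets containing n,
-- "first defined entry" determines a duplicate-free list.  Hence valid
-- equations have equal normal forms, and so are derivable.
module Submission where

open import Defs
open import Function.Bundles using (_⇔_; mk⇔)
open import Function.Base using (flip; _∘_)
open import Data.Nat using (ℕ; _≟_)
open import Data.Bool using (Bool; true; false; if_then_else_; _∨_)
open import Data.Bool.Properties using (∨-zeroʳ)
open import Data.Maybe using (Maybe; just; nothing; _<∣>_)
open import Data.Maybe.Properties using (<∣>-assoc; <∣>-idem; <∣>-identityʳ; just-injective)
open import Data.List using (List; []; _∷_; _++_; foldr; filter; deduplicate)
open import Data.List.Properties using (filter-accept; filter-reject)
open import Data.List.Relation.Unary.All using (All; []; _∷_)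
open import Data.List.Relation.Unary.AllPairs using ([]; _∷_)
open import Data.List.Relation.Unary.Unique.Propositional using (Unique)
open import Data.List.Relation.Unary.Unique.DecPropositional.Properties _≟_ using (deduplicate-!)
open import Data.Unit using (⊤; tt)
open import Data.Empty using (⊥-elim)
open import Relation.Nullary using (¬_; ¬?; yes; no; does)
open import Relation.Nullary.Decidable using (dec-true; dec-false)
open import Relation.Binary.Bundles using (Setoid)
open import Relation.Binary.PropositionalEquality using (_≡_; _≢_; refl; sym; trans; cong; cong₂)

eval : ∀ {Y : Set} → Term → (ℕ → Maybe Y) → Maybe Y
eval (var n)  ρ = ρ n
eval (t ⊔ₜ u) ρ = eval t ρ <∣> eval u ρ

⊔-pointwise : ∀ {X Y : Set} (f g : PFun X Y) (x : X) → (f ⊔ g) x ≡ f x <∣> g x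
⊔-pointwise f g x with f x
... | just _  = refl
... | nothing = refl

⟦⟧-eval : ∀ {X Y : Set} t (v : ℕ → PFun X Y) (x : X) → ⟦ t ⟧ v x ≡ eval t (λ n → v n x)
⟦⟧-eval (var n)  v x = refl
⟦⟧-eval (t ⊔ₜ u) v x =
  trans (⊔-pointwise (⟦ t ⟧ v) (⟦ u ⟧ v) x) (cong₂ _<∣>_ (⟦⟧-eval t v x) (⟦⟧-eval u v x))

<∣>-leftRegular : ∀ {Y : Set} (a b : Maybe Y) → (a <∣> b) <∣> a ≡ a <∣> b
<∣>-leftRegular (just _) b        = refl
<∣>-leftRegular nothing  (just _) = refl
<∣>-leftRegular nothing  nothing  = refl

eval-sound : ∀ {Y : Set} {t u} → t ⊢≈ u → (ρ : ℕ → Maybe Y) → eval t ρ ≡ eval u ρ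
eval-sound (assoc a b c) ρ = sym (<∣>-assoc (eval a ρ) (eval b ρ) (eval c ρ))
eval-sound (idem a)      ρ = <∣>-idem (eval a ρ)
eval-sound (lreg a b)    ρ = <∣>-leftRegular (eval a ρ) (eval b ρ)
eval-sound refl≈         ρ = refl
eval-sound (sym≈ d)      ρ = sym (eval-sound d ρ)
eval-sound (trans≈ d e)  ρ = trans (eval-sound d ρ) (eval-sound e ρ)
eval-sound (cong≈ d e)   ρ = cong₂ _<∣>_ (eval-sound d ρ) (eval-sound e ρ)

-- Soundness: derivable equations are valid in every {⊔}-algebra of functions
-- (even for assignments outside the algebra).
soundness : ∀ {t u} → t ⊢≈ u → ⊨ t ≈ u
soundness {t} {u} d A v _ x =
  trans (⟦⟧-eval t v x) (trans (eval-sound d (λ n → v n x)) (sym (⟦⟧-eval u v x)))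

hd : Term → ℕ
hd (var a)  = a
hd (t ⊔ₜ u) = hd t

tl : Term → List ℕ
tl (var a)  = []
tl (t ⊔ₜ u) = tl t ++ (hd u ∷ tl u)

-- All variable occurrences from left to right;
-- note  word (t ⊔ₜ u) = word t ++ word u  holds by computation.
word : Term → List ℕ
word t = hd t ∷ tl t

firstDefined : ∀ {Y : Set} → (ℕ → Maybe Y) → List ℕ → Maybe Y
firstDefined ρ = foldr (λ b m → ρ b <∣> m) nothing

firstDefined-++ : ∀ {Y : Set} (ρ : ℕ → Maybe Y) l k →
                  firstDefined ρ (l ++ k) ≡ firstDefined ρ l <∣> firstDefined ρ k
firstDefined-++ ρ []      k = refl
firstDefined-++ ρ (b ∷ l) k =
  trans (cong (ρ b <∣>_) (firstDefined-++ ρ l k)) (sym (<∣>-assoc (ρ b) _ _))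

eval-word : ∀ {Y : Set} t (ρ : ℕ → Maybe Y) → eval t ρ ≡ firstDefined ρ (word t)
eval-word (var a)  ρ = sym (<∣>-identityʳ (ρ a))
eval-word (t ⊔ₜ u) ρ =
  trans (cong₂ _<∣>_ (eval-word t ρ) (eval-word u ρ)) (sym (firstDefined-++ ρ (word t) (word u)))

-- Removing all occurrences of x from a list (deduplicate uses exactly this filter).
delete : ℕ → List ℕ → List ℕ
delete x = filter (λ b → ¬? (x ≟ b))

delete-here : ∀ x l → delete x (x ∷ l) ≡ delete x l
delete-here x l = filter-reject (λ b → ¬? (x ≟ b)) (λ x≢x → x≢x refl)

delete-there : ∀ {x b} l → x ≢ b → delete x (b ∷ l) ≡ b ∷ delete x l
delete-there {x} l x≢b = filter-accept (λ b → ¬? (x ≟ b)) x≢b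

firstDefined-delete : ∀ {Y : Set} (ρ : ℕ → Maybe Y) {x} → ρ x ≡ nothing →
                      ∀ l → firstDefined ρ (delete x l) ≡ firstDefined ρ l
firstDefined-delete ρ ρx≡nothing []      = refl
firstDefined-delete ρ {x} ρx≡nothing (b ∷ l) with x ≟ b
... | yes refl rewrite delete-here x l | ρx≡nothing = firstDefined-delete ρ ρx≡nothing l
... | no x≢b   rewrite delete-there l x≢b = cong (ρ b <∣>_) (firstDefined-delete ρ ρx≡nothing l)

-- Deduplication only removes occurrences after the first one, which can
-- never be the first defined entry.
firstDefined-deduplicate : ∀ {Y : Set} (ρ : ℕ → Maybe Y) l →
                           firstDefined ρ (deduplicate _≟_ l) ≡ firstDefined ρ l
firstDefined-deduplicate ρ []      = refl
firstDefined-deduplicate ρ (x ∷ l) with ρ x in ρx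
... | just _  = refl
... | nothing =
  trans (firstDefined-delete ρ ρx (deduplicate _≟_ l)) (firstDefined-deduplicate ρ l)

≈-setoid : Setoid _ _
≈-setoid = record
  { Carrier       = Term
  ; _≈_           = _⊢≈_
  ; isEquivalence = record { refl = refl≈ ; sym = sym≈ ; trans = trans≈ }
  }

open import Relation.Binary.Reasoning.Setoid ≈-setoid

infixl 6 _◁_
_◁_ : Term → List ℕ → Term
s ◁ []      = s
s ◁ (b ∷ l) = (s ⊔ₜ var b) ◁ l

◁-++ : ∀ s l k → s ◁ (l ++ k) ≡ s ◁ l ◁ k
◁-++ s []      k = refl
◁-++ s (b ∷ l) k = ◁-++ (s ⊔ₜ var b) l k

◁-cong : ∀ {s s'} l → s ⊢≈ s' → s ◁ l ⊢≈ s' ◁ l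
◁-cong []      d = d
◁-cong (b ∷ l) d = ◁-cong l (cong≈ d refl≈)

⊔-word : ∀ s u → s ⊔ₜ u ⊢≈ s ◁ word u
⊔-word s (var b)  = refl≈
⊔-word s (u ⊔ₜ w) = begin
  s ⊔ₜ (u ⊔ₜ w)        ≈⟨ assoc s u w ⟩
  (s ⊔ₜ u) ⊔ₜ w        ≈⟨ ⊔-word (s ⊔ₜ u) w ⟩
  s ⊔ₜ u ◁ word w      ≈⟨ ◁-cong (word w) (⊔-word s u) ⟩
  s ◁ word u ◁ word w  ≡⟨ ◁-++ s (word u) (word w) ⟨
  s ◁ word (u ⊔ₜ w)    ∎

word-join : ∀ t → t ⊢≈ var (hd t) ◁ tl t
word-join (var a)  = refl≈
word-join (t ⊔ₜ u) = begin
  t ⊔ₜ u                                ≈⟨ cong≈ (word-join t) refl≈ ⟩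
  (var (hd t) ◁ tl t) ⊔ₜ u              ≈⟨ ⊔-word (var (hd t) ◁ tl t) u ⟩
  var (hd t) ◁ tl t ◁ word u            ≡⟨ ◁-++ (var (hd t)) (tl t) (word u) ⟨
  var (hd t) ◁ tl (t ⊔ₜ u)              ∎

Absorbs : Term → ℕ → Set
Absorbs s b = s ⊔ₜ var b ⊢≈ s

absorbs-last : ∀ s b → Absorbs (s ⊔ₜ var b) b
absorbs-last s b = trans≈ (sym≈ (assoc s (var b) (var b))) (cong≈ refl≈ (idem (var b)))

-- Absorption survives joining further terms; this is where left
-- regularity is used.
absorbs-⊔ : ∀ {s b} c → Absorbs s b → Absorbs (s ⊔ₜ c) b
absorbs-⊔ {s} {b} c sb = begin
  (s ⊔ₜ c) ⊔ₜ var b                  ≈⟨ cong≈ (cong≈ sb refl≈) refl≈ ⟨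
  ((s ⊔ₜ var b) ⊔ₜ c) ⊔ₜ var b       ≈⟨ assoc (s ⊔ₜ var b) c (var b) ⟨
  (s ⊔ₜ var b) ⊔ₜ (c ⊔ₜ var b)       ≈⟨ assoc s (var b) (c ⊔ₜ var b) ⟨
  s ⊔ₜ (var b ⊔ₜ (c ⊔ₜ var b))       ≈⟨ cong≈ refl≈ (assoc (var b) c (var b)) ⟩
  s ⊔ₜ ((var b ⊔ₜ c) ⊔ₜ var b)       ≈⟨ cong≈ refl≈ (lreg (var b) c) ⟩
  s ⊔ₜ (var b ⊔ₜ c)                  ≈⟨ assoc s (var b) c ⟩
  (s ⊔ₜ var b) ⊔ₜ c                  ≈⟨ cong≈ sb refl≈ ⟩
  s ⊔ₜ c                             ∎

◁-delete : ∀ {s x} l → Absorbs s x → s ◁ l ⊢≈ s ◁ delete x l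
◁-delete     []      sx = refl≈
◁-delete {x = x} (b ∷ l) sx with x ≟ b
... | yes refl rewrite delete-here x l = trans≈ (◁-cong l sx) (◁-delete l sx)
... | no x≢b   rewrite delete-there l x≢b = ◁-delete l (absorbs-⊔ (var b) sx)

◁-deduplicate : ∀ s l → s ◁ l ⊢≈ s ◁ deduplicate _≟_ l
◁-deduplicate s []      = refl≈
◁-deduplicate s (x ∷ l) =
  trans≈ (◁-deduplicate (s ⊔ₜ var x) l)
         (◁-delete (deduplicate _≟_ l) (absorbs-last s x))

-- The normal form: the join of  deduplicate (word t) = hd t ∷ normalTail t.
normalTail : Term → List ℕ
normalTail t = delete (hd t) (deduplicate _≟_ (tl t))

nf : Term → Term
nf t = var (hd t) ◁ normalTail t

normalise : ∀ t → t ⊢≈ nf t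
normalise t = begin
  t                                      ≈⟨ word-join t ⟩
  var (hd t) ◁ tl t                      ≈⟨ ◁-deduplicate (var (hd t)) (tl t) ⟩
  var (hd t) ◁ deduplicate _≟_ (tl t)    ≈⟨ ◁-delete (deduplicate _≟_ (tl t)) (idem (var (hd t))) ⟩
  nf t                                   ∎

Point : Set
Point = ℕ → Bool

mark : Point → ℕ → Maybe ℕ
mark S n = if S n then just n else nothing

Full : ⊔-Algebra
Full = record
  { X = Point ; Y = ℕ ; x₀ = λ _ → false ; y₀ = 0
  ; carrier = λ _ → ⊤ ; closed = λ _ _ → tt }

firstMarked : Point → List ℕ → Maybe ℕ
firstMarked S = firstDefined (mark S)

firstMarked-head : ∀ {S b} l → S b ≡ true → firstMarked S (b ∷ l) ≡ just b
firstMarked-head l Sb rewrite Sb = refl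

firstMarked-skip : ∀ {S b} l → S b ≡ false → firstMarked S (b ∷ l) ≡ firstMarked S l
firstMarked-skip l Sb rewrite Sb = refl

_∖_ : Point → ℕ → Point
(S ∖ a) n = if does (n ≟ a) then false else S n

firstMarked-∖ : ∀ S {a} l → All (a ≢_) l → firstMarked (S ∖ a) l ≡ firstMarked S l
firstMarked-∖ S []      []           = refl
firstMarked-∖ S {a} (b ∷ l) (a≢b ∷ a∉l)
  rewrite dec-false (b ≟ a) (a≢b ∘ sym) = cong (mark S b <∣>_) (firstMarked-∖ S l a∉l)

pair : ℕ → ℕ → Point
pair a b n = does (n ≟ a) ∨ does (n ≟ b)

pair-left : ∀ a b → pair a b a ≡ true
pair-left a b rewrite dec-true (a ≟ a) refl = refl

pair-right : ∀ a b → pair a b b ≡ true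
pair-right a b rewrite dec-true (b ≟ b) refl = ∨-zeroʳ (does (b ≟ a))

firstMarked-nonempty : ∀ b l → ¬ (∀ S → nothing ≡ firstMarked S (b ∷ l))
firstMarked-nonempty b l h with () ← trans (h (pair b b)) (firstMarked-head l (pair-left b b))

-- Duplicate-free lists are determined by their first marked entries:
-- the set {a, b} identifies the heads, and removing the head from each
-- point reduces to the tails.
firstMarked-injective : ∀ {l k} → Unique l → Unique k →
                        (∀ S → firstMarked S l ≡ firstMarked S k) → l ≡ k
firstMarked-injective [] [] h = refl
firstMarked-injective [] (_∷_ {b} {k} _ _) h = ⊥-elim (firstMarked-nonempty b k h)
firstMarked-injective (_∷_ {a} {l} _ _) [] h = ⊥-elim (firstMarked-nonempty a l (sym ∘ h))
firstMarked-injective (_∷_ {a} {l} a∉l ul) (_∷_ {b} {k} b∉k uk) h with heads-equal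
  where
  heads-equal : a ≡ b
  heads-equal = just-injective (trans (sym (firstMarked-head l (pair-left a b)))
                               (trans (h (pair a b)) (firstMarked-head k (pair-right a b))))
... | refl = cong (a ∷_) (firstMarked-injective ul uk tails-equal)
  where
  tails-equal : ∀ S → firstMarked S l ≡ firstMarked S k
  tails-equal S = trans (sym (firstMarked-∖ S l a∉l))
                  (trans (sym (firstMarked-skip l removed))
                  (trans (h (S ∖ a))
                  (trans (firstMarked-skip k removed) (firstMarked-∖ S k b∉k))))
    where
    removed : (S ∖ a) a ≡ false
    removed rewrite dec-true (a ≟ a) refl = refl

⟦⟧-normalWord : ∀ t S → ⟦ t ⟧ (flip mark) S ≡ firstMarked S (deduplicate _≟_ (word t))
⟦⟧-normalWord t S =
  trans (⟦⟧-eval t (flip mark) S)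
        (trans (eval-word t (mark S)) (sym (firstDefined-deduplicate (mark S) (word t))))

valid-normalWord : ∀ t u → ⊨ t ≈ u → deduplicate _≟_ (word t) ≡ deduplicate _≟_ (word u)
valid-normalWord t u valid =
  firstMarked-injective (deduplicate-! (word t)) (deduplicate-! (word u)) λ S →
    trans (sym (⟦⟧-normalWord t S))
          (trans (valid Full (flip mark) (λ _ → tt) S) (⟦⟧-normalWord u S))

join-cong : ∀ {x y l k} → x ∷ l ≡ y ∷ k → var x ◁ l ≡ var y ◁ k
join-cong refl = refl

completeness : ∀ t u → ⊨ t ≈ u → t ⊢≈ u
completeness t u valid = begin
  t     ≈⟨ normalise t ⟩
  nf t  ≡⟨ join-cong (valid-normalWord t u valid) ⟩
  nf u  ≈⟨ normalise u ⟨
  u     ∎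

corollary4p2 : ∀ (t u : Term) → (⊨ t ≈ u) ⇔ (t ⊢≈ u)
corollary4p2 t u = mk⇔ (completeness t u) soundness
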